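{- Let $G$ be a finite, simple, connected unicyclic graph with unique cycle $C$, and let $S\subseteq V(G)$ be a branch-resolving set with $a(S)\ge 2$. Then any two distinct vertices lying in the same connected component of $G-E(C)$ are distinguished by $S$, and any two distinct edges lying in the same connected component of $G-E(C)$ are distinguished by $S$.
   Context: A unicyclic graph is a connected graph containing exactly one cycle, denoted $C$. For $v_i\in V(C)$, $T_{v_i}$ denotes the connected component of $G-E(C)$ containing $v_i$. For vertices $u,v$, $d(u,v)$ is the distance; for an edge $e=uv$ and vertex $s$, $d(e,s)=\min\{d(u,s),d(v,s)\}$. A vertex $s$ distinguishes vertices $u,v$ if $d(u,s)\ne d(v,s)$, and edges $e,f$ if $d(e,s)\ne d(f,s)$; a set $S$ distinguishes a pair if some $s\in S$ does. A thread is a path $u_1\cdots u_k$ in which all vertices have degree $2$ except $u_k$, which has degree $1$, and $u_1$ is adjacent to a vertex $v$ with $\deg(v)\ge3$ (the thread is attached to $v$). A set $S\subseteq V(G)$ is branch-resolving if for every vertex $v$ of degree at least $3$, $S$ contains a vertex from each of the threads attached to $v$ except possibly one. A vertex $v_i\in V(C)$ is $S$-active if $T_{v_i}$ contains a vertex of $S$; $a(S)$ is the number of $S$-active vertices on $C$. -}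

module Defs where

open import Data.Nat using (ℕ; zero; suc; _≤_; _⊓_)
open import Data.Bool using (Bool; true; false; T)
open import Data.Fin using (Fin)
open import Data.Fin.Subset using (Subset; _∈_; _∉_)
open import Data.List using (List; []; _∷_; _++_; length; filterᵇ; take)
open import Data.List.Relation.Unary.All using (All)
open import Data.List.Relation.Unary.Linked using (Linked)
open import Data.List.Relation.Unary.Unique.Propositional using (Unique)
open import Data.List.Membership.Propositional using () renaming (_∈_ to _∈L_)
open import Data.List using (allFin)
open import Data.Product using (Σ; ∃; ∃-syntax; _×_; _,_)
open import Data.Sum using (_⊎_)
open import Relation.Nullary using (¬_)
open import Relation.Binary.PropositionalEquality using (_≡_; _≢_)

record Graph (n : ℕ) : Set where
  field
    adj   : Fin n → Fin n → Bool
    sym   : ∀ u v → adj u v ≡ adj v u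
    irrefl : ∀ v → adj v v ≡ false
open Graph public

module _ {n : ℕ} where

  data Walk (R : Fin n → Fin n → Set) : Fin n → Fin n → ℕ → Set where
    nil  : ∀ {u} → Walk R u u 0
    cons : ∀ {u w v k} → R u w → Walk R w v k → Walk R u v (suc k)

  Adj : Graph n → Fin n → Fin n → Set
  Adj G u v = T (adj G u v)

  Connected : Graph n → Set
  Connected G = ∀ u v → ∃[ k ] Walk (Adj G) u v k

  Dist : Graph n → Fin n → Fin n → ℕ → Set
  Dist G u v k = Walk (Adj G) u v k × (∀ m → Walk (Adj G) u v m → k ≤ m)

  DistE : Graph n → Fin n → Fin n → Fin n → ℕ → Set
  DistE G a b s m = ∃[ k ] ∃[ l ] (Dist G a s k × Dist G b s l × m ≡ k ⊓ l)

  deg : Graph n → Fin n → ℕ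
  deg G v = length (filterᵇ (adj G v) (allFin n))

  data Consec {A : Set} : List A → A → A → Set where
    here  : ∀ {a b l} → Consec (a ∷ b ∷ l) a b
    there : ∀ {x a b l} → Consec l a b → Consec (x ∷ l) a b

  close : List (Fin n) → List (Fin n)
  close c = c ++ take 1 c

  CycEdge : List (Fin n) → Fin n → Fin n → Set
  CycEdge c u v = Consec (close c) u v ⊎ Consec (close c) v u

  IsCycle : Graph n → List (Fin n) → Set
  IsCycle G c = 3 ≤ length c × Unique c × (∀ u v → Consec (close c) u v → Adj G u v)

  -- every cycle of G has the same edge set as c, i.e. c is the unique cycle
  UniqueCycle : Graph n → List (Fin n) → Set
  UniqueCycle G c = ∀ c' → IsCycle G c' → ∀ u v →
    (CycEdge c' u v → CycEdge c u v) × (CycEdge c u v → CycEdge c' u v)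

  AdjMinus : Graph n → List (Fin n) → Fin n → Fin n → Set
  AdjMinus G c u v = Adj G u v × ¬ CycEdge c u v

  SameComp : Graph n → List (Fin n) → Fin n → Fin n → Set
  SameComp G c u v = ∃[ k ] Walk (AdjMinus G c) u v k

  Thread : Graph n → Fin n → List (Fin n) → Set
  Thread G v t =
    Unique t × Linked (Adj G) t × 3 ≤ deg G v ×
    (∃[ u₁ ] ∃[ rest ] (t ≡ u₁ ∷ rest × Adj G v u₁)) ×
    (∃[ ini ] ∃[ uₖ ] (t ≡ ini ++ (uₖ ∷ []) × All (λ w → deg G w ≡ 2) ini × deg G uₖ ≡ 1))

  -- S contains a vertex of every thread attached to v, except possibly one
  BranchResolving : Graph n → Subset n → Set
  BranchResolving G S = ∀ v → 3 ≤ deg G v → ∀ t t' → Thread G v t → Thread G v t' →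
    All (_∉ S) t → All (_∉ S) t' → t ≡ t'

  Active : Graph n → List (Fin n) → Subset n → Fin n → Set
  Active G c S v = v ∈L c × ∃[ s ] (s ∈ S × SameComp G c v s)

  AtLeastTwoActive : Graph n → List (Fin n) → Subset n → Set
  AtLeastTwoActive G c S = ∃[ v ] ∃[ w ] (v ≢ w × Active G c S v × Active G c S w)

  DistinguishesV : Graph n → Subset n → Fin n → Fin n → Set
  DistinguishesV G S u v = ∃[ s ] (s ∈ S × ∃[ k ] ∃[ l ] (Dist G u s k × Dist G v s l × k ≢ l))

  DistinguishesE : Graph n → Subset n → Fin n → Fin n → Fin n → Fin n → Set
  DistinguishesE G S a b x y =
    ∃[ s ] (s ∈ S × ∃[ k ] ∃[ l ] (DistE G a b s k × DistE G x y s l × k ≢ l))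

  SameEdge : Fin n → Fin n → Fin n → Fin n → Set
  SameEdge a b x y = (a ≡ x × b ≡ y) ⊎ (a ≡ y × b ≡ x)

-- Fix the component T of G − E(C) through a cycle vertex r.  As C is the only cycle, T is a tree
-- layered by h = d(·, r): adjacent vertices of T lie on consecutive levels, and every vertex other
-- than r has exactly one neighbour one level down.  Since a(S) ≥ 2, some s₀ ∈ S lies outside T, and
-- every shortest path from T to s₀ leaves through r, so s₀ separates vertices (and edges, measured at
-- their lower end) on different levels.  Two vertices on the same level branch apart at a lowest
-- common ancestor w, into children u′ ≠ v′.  Not both subtrees below u′ and v′ avoid S: an S-free
-- subtree hanging below a non-root vertex is a thread, and w has a third neighbour (its parent, or a
-- cycle neighbour when w = r), so two S-free threads at w would contradict branch resolution.  A
-- vertex of S below u′ is strictly closer to the side of u′, as reaching the other side costs the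
-- detour through w.

module Submission where

open import Defs hiding (sym)
open import Data.Bool using (T)
open import Data.Bool.Properties using (T?)
open import Data.Empty using (⊥; ⊥-elim)
open import Data.Fin using (Fin) renaming (_≟_ to _≟F_)
open import Data.Fin.Properties using (any?)
open import Data.Fin.Subset using (Subset; _∈_; _∉_)
import Data.Fin.Subset.Properties as Subset
open import Data.List using (List; []; _∷_; _++_; length; allFin)
open import Data.List.Properties using (length-++; length-++-sucʳ; length-tabulate; ++-assoc; ∷-injectiveˡ)
open import Data.List.Membership.Propositional using () renaming (_∈_ to _∈L_; _∉_ to _∉L_)
open import Data.List.Membership.Propositional.Properties
  using (∈-++⁺ˡ; ∈-++⁺ʳ; ∈-++⁻; ∈-∃++; ∈-allFin; ∈-filter⁺; ∈-filter⁻)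
import Data.List.Membership.DecPropositional as DecMembership
open import Data.List.Relation.Binary.Subset.Propositional using (_⊆_)
open import Data.List.Relation.Unary.All as All using (All; []; _∷_)
import Data.List.Relation.Unary.All.Properties as All
open import Data.List.Relation.Unary.Any using (here; there)
open import Data.List.Relation.Unary.Linked using (Linked; [-]; _∷_)
open import Data.List.Relation.Unary.Unique.Propositional using (Unique; []; _∷_)
import Data.List.Relation.Unary.Unique.Propositional.Properties as Unique
open import Data.Nat using (ℕ; zero; suc; _+_; _≤_; _<_; z≤n; s≤s; _⊓_)
open import Data.Nat.Properties
open import Data.Product using (∃; ∃-syntax; _×_; _,_; proj₁; proj₂)
open import Function using (_∘_)
open import Data.Sum using (_⊎_; inj₁; inj₂)
open import Relation.Binary.Definitions using (tri<; tri≈; tri>)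
open import Relation.Binary.PropositionalEquality
  using (_≡_; _≢_; ≢-sym; refl; sym; trans; cong; cong₂; subst; module ≡-Reasoning)
open import Relation.Nullary using (¬_; Dec; yes; no; ¬?)
open import Relation.Nullary.Decidable using (_×-dec_)

module _ {A : Set} where

  Unique-∷ʳ : ∀ {xs : List A} {y} → Unique xs → y ∉L xs → Unique (xs ++ y ∷ [])
  Unique-∷ʳ {[]} _ _ = [] ∷ []
  Unique-∷ʳ {x ∷ xs} (x∉xs ∷ u) y∉ =
    All.++⁺ x∉xs ((λ x≡y → y∉ (here (sym x≡y))) ∷ []) ∷ Unique-∷ʳ u (λ m → y∉ (there m))

  Unique-++⁻ˡ : ∀ (xs : List A) {ys} → Unique (xs ++ ys) → Unique xs
  Unique-++⁻ˡ [] _ = []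
  Unique-++⁻ˡ (x ∷ xs) (x∉ ∷ u) = All.++⁻ˡ xs x∉ ∷ Unique-++⁻ˡ xs u

  Unique-++⁻ʳ : ∀ (xs : List A) {ys} → Unique (xs ++ ys) → Unique ys
  Unique-++⁻ʳ [] u = u
  Unique-++⁻ʳ (x ∷ xs) (_ ∷ u) = Unique-++⁻ʳ xs u

  Unique-∷ʳ-∉ : ∀ (xs : List A) {y} → Unique (xs ++ y ∷ []) → ∀ {z} → z ∈L xs → z ≢ y
  Unique-∷ʳ-∉ (x ∷ xs) (x∉ ∷ _) (here refl) = All.lookup x∉ (∈-++⁺ʳ xs (here refl))
  Unique-∷ʳ-∉ (x ∷ xs) (_ ∷ u) (there m) = Unique-∷ʳ-∉ xs u m

  Unique⇒length≤ : ∀ {xs ys : List A} → Unique xs → xs ⊆ ys → length xs ≤ length ys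
  Unique⇒length≤ {[]} _ _ = z≤n
  Unique⇒length≤ {x ∷ xs} (x∉xs ∷ u) xs⊆ys with ∈-∃++ (xs⊆ys (here refl))
  ... | P , Q , refl = subst (length xs <_) (sym (length-++-sucʳ P x Q))
          (s≤s (Unique⇒length≤ u (λ m → drop-x (xs⊆ys (there m)) (λ z≡x → All.lookup x∉xs m (sym z≡x)))))
    where
    drop-x : ∀ {z} → z ∈L P ++ x ∷ Q → z ≢ x → z ∈L P ++ Q
    drop-x m z≢x with ∈-++⁻ P m
    ... | inj₁ m′ = ∈-++⁺ˡ m′
    ... | inj₂ (here z≡x) = ⊥-elim (z≢x z≡x)
    ... | inj₂ (there m′) = ∈-++⁺ʳ P m′

module _ {n : ℕ} where

  -- Consec takes the size parameter of an anonymous module of Defs, which its arguments do not determine.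
  Consecutive : List (Fin n) → Fin n → Fin n → Set
  Consecutive = Consec {n}

  Consec-++⁺ˡ : ∀ {xs ys u v} → Consecutive xs u v → Consecutive (xs ++ ys) u v
  Consec-++⁺ˡ here = here
  Consec-++⁺ˡ (there q) = there (Consec-++⁺ˡ q)

  Consec-++⁺ʳ : ∀ xs {ys u v} → Consecutive ys u v → Consecutive (xs ++ ys) u v
  Consec-++⁺ʳ [] q = q
  Consec-++⁺ʳ (x ∷ xs) q = there (Consec-++⁺ʳ xs q)

  Consec⇒∈ : ∀ {xs u v} → Consecutive xs u v → u ∈L xs × v ∈L xs
  Consec⇒∈ here = here refl , there (here refl)
  Consec⇒∈ (there q) with Consec⇒∈ q
  ... | u∈ , v∈ = there u∈ , there v∈

  Consec? : ∀ xs u v → Dec (Consecutive xs u v)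
  Consec? [] u v = no λ ()
  Consec? (x ∷ []) u v = no λ { (there ()) }
  Consec? (x ∷ y ∷ xs) u v with x ≟F u | y ≟F v | Consec? (y ∷ xs) u v
  ... | _ | _ | yes q = yes (there q)
  ... | yes refl | yes refl | no _ = yes here
  ... | no x≢u | _ | no ¬q = no λ { here → x≢u refl ; (there q) → ¬q q }
  ... | yes _ | no y≢v | no ¬q = no λ { here → y≢v refl ; (there q) → ¬q q }

  ∈-close⁻ : ∀ (xs : List (Fin n)) {x} → x ∈L close xs → x ∈L xs
  ∈-close⁻ [] m = m
  ∈-close⁻ (y ∷ ys) m with ∈-++⁻ (y ∷ ys) m
  ... | inj₁ m′ = m′
  ... | inj₂ (here x≡y) = here x≡y

  close-successor : ∀ (xs : List (Fin n)) {x} → x ∈L xs → ∃[ z ] Consecutive (close xs) x z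
  close-successor (y ∷ ys) = go (y ∷ ys)
    where
    go : ∀ zs {x} → x ∈L zs → ∃[ z ] Consecutive (zs ++ y ∷ []) x z
    go (x ∷ []) (here refl) = y , here
    go (x ∷ x′ ∷ zs) (here refl) = x′ , here
    go (x ∷ zs) (there m) with go zs m
    ... | z , q = z , there q

  SameEdge-sym : ∀ {a b x y : Fin n} → SameEdge a b x y → SameEdge x y a b
  SameEdge-sym (inj₁ (refl , refl)) = inj₁ (refl , refl)
  SameEdge-sym (inj₂ (refl , refl)) = inj₂ (refl , refl)

  SameEdge-trans : ∀ {a b x y u v : Fin n} → SameEdge a b x y → SameEdge x y u v → SameEdge a b u v
  SameEdge-trans (inj₁ (refl , refl)) e = e
  SameEdge-trans (inj₂ (refl , refl)) (inj₁ (refl , refl)) = inj₂ (refl , refl)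
  SameEdge-trans (inj₂ (refl , refl)) (inj₂ (refl , refl)) = inj₁ (refl , refl)

  SameEdge-⊓ : ∀ (f : Fin n → ℕ) {a b x y} → SameEdge a b x y → f a ⊓ f b ≡ f x ⊓ f y
  SameEdge-⊓ f (inj₁ (refl , refl)) = refl
  SameEdge-⊓ f (inj₂ (refl , refl)) = ⊓-comm (f _) (f _)

  data Path (R : Fin n → Fin n → Set) : Fin n → Fin n → List (Fin n) → Set where
    [_]  : ∀ x → Path R x x (x ∷ [])
    _∷_ : ∀ {x y z L} → R x y → Path R y z L → Path R x z (x ∷ L)

  module _ {R : Fin n → Fin n → Set} where

    Path-∷ʳ : ∀ {x y z L} → Path R x y L → R y z → Path R x z (L ++ z ∷ [])
    Path-∷ʳ [ _ ] r = r ∷ [ _ ]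
    Path-∷ʳ (r′ ∷ p) r = r′ ∷ Path-∷ʳ p r

    Path-++ : ∀ {x y z P Q} → Path R x y P → Path R y z (y ∷ Q) → Path R x z (P ++ Q)
    Path-++ [ _ ] q = q
    Path-++ (r ∷ p) q = r ∷ Path-++ p q

    Path-map : ∀ {R′ : Fin n → Fin n → Set} → (∀ {x y} → R x y → R′ x y) →
               ∀ {x y L} → Path R x y L → Path R′ x y L
    Path-map f [ x ] = [ x ]
    Path-map f (r ∷ p) = f r ∷ Path-map f p

    Path-edge : ∀ {x y L u v} → Path R x y L → Consecutive L u v → R u v
    Path-edge (r ∷ [ _ ]) here = r
    Path-edge (r ∷ (_ ∷ _)) here = r
    Path-edge (_ ∷ p) (there q) = Path-edge p q

    Path-head : ∀ {x y L} → Path R x y L → ∃[ L′ ] L ≡ x ∷ L′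
    Path-head [ _ ] = _ , refl
    Path-head (_ ∷ _) = _ , refl

    Path-last : ∀ {x y L} → Path R x y L → ∃[ I ] L ≡ I ++ y ∷ []
    Path-last [ _ ] = [] , refl
    Path-last {x} (_ ∷ p) with Path-last p
    ... | I , refl = x ∷ I , refl

    Path-length : ∀ {x y L} → Path R x y L → x ≢ y → 2 ≤ length L
    Path-length [ _ ] x≢y = ⊥-elim (x≢y refl)
    Path-length (_ ∷ [ _ ]) _ = s≤s (s≤s z≤n)
    Path-length (_ ∷ (_ ∷ _)) _ = s≤s (s≤s z≤n)

2+m+n≤m+[n+k] : ∀ m n {k} → 2 ≤ k → 2 + (m + n) ≤ m + (n + k)
2+m+n≤m+[n+k] m n {k} 2≤k = begin
  2 + (m + n) ≡⟨ +-comm 2 (m + n) ⟩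
  m + n + 2   ≤⟨ +-monoʳ-≤ (m + n) 2≤k ⟩
  m + n + k   ≡⟨ +-assoc m n k ⟩
  m + (n + k) ∎
  where
  open ≤-Reasoning

record Least (P : ℕ → Set) : Set where
  constructor least
  field
    value   : ℕ
    holds   : P value
    minimal : ∀ k → P k → value ≤ k

find-least : ∀ {P : ℕ → Set} → (∀ m → Dec (P m)) → ∀ k → P k → Least P
find-least P? zero p = least 0 p (λ _ _ → z≤n)
find-least P? (suc k) p with P? 0
... | yes p0 = least 0 p0 (λ _ _ → z≤n)
... | no ¬p0 with find-least (λ m → P? (suc m)) k p
...   | least v pv min = least (suc v) pv λ { zero p0 → ⊥-elim (¬p0 p0) ; (suc j) pj → s≤s (min j pj) }

module _ {n : ℕ} {R : Fin n → Fin n → Set} where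

  Walk? : (∀ u v → Dec (R u v)) → ∀ m u v → Dec (Walk R u v m)
  Walk? R? zero u v with u ≟F v
  ... | yes refl = yes nil
  ... | no u≢v = no λ { nil → u≢v refl }
  Walk? R? (suc m) u v with any? (λ w → R? u w ×-dec Walk? R? m w v)
  ... | yes (w , r , p) = yes (cons r p)
  ... | no ¬w = no λ { (cons r p) → ¬w (_ , r , p) }

  Walk-++ : ∀ {u v w k l} → Walk R u v k → Walk R v w l → Walk R u w (k + l)
  Walk-++ nil q = q
  Walk-++ (cons r p) q = cons r (Walk-++ p q)

  Walk-reverse : (∀ {u v} → R u v → R v u) → ∀ {u v k} → Walk R u v k → Walk R v u k
  Walk-reverse R-sym nil = nil
  Walk-reverse R-sym (cons r p) = snoc (Walk-reverse R-sym p) (R-sym r)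
    where
    snoc : ∀ {u v w k} → Walk R u v k → R v w → Walk R u w (suc k)
    snoc nil r = cons r nil
    snoc (cons r′ p) r = cons r′ (snoc p r)

  Walk-via-gate : (P : Fin n → Set) (b : Fin n) → (∀ {x z} → P x → x ≢ b → R x z → P z) →
                  ∀ {x y m} → P x → ¬ P y → Walk R x y m →
                  ∃[ m₁ ] ∃[ m₂ ] m₁ + m₂ ≡ m × Walk R x b m₁ × Walk R b y m₂
  Walk-via-gate P b P-closed px ¬py nil = ⊥-elim (¬py px)
  Walk-via-gate P b P-closed {x} px ¬py (cons r p) with x ≟F b
  ... | yes refl = 0 , _ , refl , nil , cons r p
  ... | no x≢b with Walk-via-gate P b P-closed (P-closed px x≢b r) ¬py p
  ...   | m₁ , m₂ , m≡ , p₁ , p₂ = suc m₁ , m₂ , cong suc m≡ , cons r p₁ , p₂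

  Walk-0 : ∀ {u v} → Walk R u v 0 → u ≡ v
  Walk-0 nil = refl

  Shortest : Fin n → Fin n → ℕ → Set
  Shortest u v k = Walk R u v k × (∀ m → Walk R u v m → k ≤ m)

  Shortest-unique : ∀ {u v k l} → Shortest u v k → Shortest u v l → k ≡ l
  Shortest-unique (p , p-min) (q , q-min) = ≤-antisym (p-min _ q) (q-min _ p)

  Shortest-step : ∀ {u v k} → Shortest u v (suc k) → ∃[ w ] R u w × Shortest w v k
  Shortest-step (cons r p , p-min) = _ , r , p , λ m q → ≤-pred (p-min (suc m) (cons r q))

  Shortest-reverse : (∀ {u v} → R u v → R v u) → ∀ {u v k} → Shortest u v k → Shortest v u k
  Shortest-reverse R-sym (p , p-min) = Walk-reverse R-sym p , λ m q → p-min m (Walk-reverse R-sym q)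

  shortest-path : ∀ {u v k} → Shortest u v k → ∃[ M ]
    Path R u v (u ∷ M) × Unique (u ∷ M) × length M ≡ k ×
    All (λ z → ∃[ j ] j < k × Shortest z v j) M
  shortest-path {k = zero} sh with Walk-0 (proj₁ sh)
  ... | refl = [] , [ _ ] , [] ∷ [] , refl , []
  shortest-path {u} {v} {suc k} sh with Shortest-step sh
  ... | w , r , sh-w with shortest-path sh-w
  ...   | M , p , u-M , len , below =
    w ∷ M , r ∷ p , (u≢w ∷ All.map (λ (_ , j<k , sh-z) → ≢u j<k sh-z) below) ∷ u-M , cong suc len ,
    (k , ≤-refl , sh-w) ∷ All.map (λ (j , j<k , sh-z) → j , m<n⇒m<1+n j<k , sh-z) below
    where
    ≢u : ∀ {z j} → j < k → Shortest z v j → u ≢ z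
    ≢u j<k sh-z refl = <-irrefl (Shortest-unique sh-z sh) (m<n⇒m<1+n j<k)
    u≢w : u ≢ w
    u≢w refl = <-irrefl (Shortest-unique sh-w sh) ≤-refl

module Adjacency {n : ℕ} (G : Graph n) where

  Adj? : ∀ u v → Dec (Adj G u v)
  Adj? u v = T? (adj G u v)

  Adj-sym : ∀ {u v} → Adj G u v → Adj G v u
  Adj-sym {u} {v} = subst T (Graph.sym G u v)

  Adj⇒≢ : ∀ {u v} → Adj G u v → u ≢ v
  Adj⇒≢ {u} a refl = subst T (irrefl G u) a

  deg-≥ : ∀ {v} L → Unique L → (∀ {y} → y ∈L L → Adj G v y) → length L ≤ deg G v
  deg-≥ {v} L u-L L-adj = Unique⇒length≤ u-L λ m → ∈-filter⁺ (T? ∘ adj G v) (∈-allFin _) (L-adj m)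

  deg-≤ : ∀ {v} L → (∀ {y} → Adj G v y → y ∈L L) → deg G v ≤ length L
  deg-≤ {v} L adj-L = Unique⇒length≤ (Unique.filter⁺ (T? ∘ adj G v) (Unique.allFin⁺ n))
                        λ m → adj-L (proj₂ (∈-filter⁻ (T? ∘ adj G v) {xs = allFin n} m))

module Distance {n : ℕ} (G : Graph n) (conn : Connected G) where
  open Adjacency G

  private
    shortest-walk : ∀ u v → Least (Walk (Adj G) u v)
    shortest-walk u v = find-least (λ m → Walk? Adj? m u v) (proj₁ (conn u v)) (proj₂ (conn u v))

  d : Fin n → Fin n → ℕ
  d u v = Least.value (shortest-walk u v)

  d-Dist : ∀ u v → Dist G u v (d u v)
  d-Dist u v = Least.holds (shortest-walk u v) , Least.minimal (shortest-walk u v)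

  d-minimal : ∀ {u v m} → Walk (Adj G) u v m → d u v ≤ m
  d-minimal = Least.minimal (shortest-walk _ _) _

  d-refl : ∀ u → d u u ≡ 0
  d-refl u = n≤0⇒n≡0 (d-minimal nil)

  d≡0⇒≡ : ∀ {u v} → d u v ≡ 0 → u ≡ v
  d≡0⇒≡ {u} {v} d≡0 = Walk-0 (subst (Walk (Adj G) u v) d≡0 (proj₁ (d-Dist u v)))

  d-sym : ∀ u v → d u v ≡ d v u
  d-sym u v = Shortest-unique (Shortest-reverse Adj-sym (d-Dist u v)) (d-Dist v u)

  d-triangle : ∀ u v w → d u w ≤ d u v + d v w
  d-triangle u v w = d-minimal (Walk-++ (proj₁ (d-Dist u v)) (proj₁ (d-Dist v w)))

  d-Adj-≤ : ∀ {u v} s → Adj G u v → d u s ≤ suc (d v s)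
  d-Adj-≤ s a = d-minimal (cons a (proj₁ (d-Dist _ s)))

  d-step : ∀ {u s k} → d u s ≡ suc k → ∃[ w ] Adj G u w × d w s ≡ k
  d-step {u} {s} d≡ with Shortest-step (subst (Dist G u s) d≡ (d-Dist u s))
  ... | w , a , sh = w , a , Shortest-unique (d-Dist w s) sh

  Adj⇒d≡1 : ∀ {u v} → Adj G u v → d u v ≡ 1
  Adj⇒d≡1 {u} {v} a = ≤-antisym (d-minimal (cons a nil)) (n≢0⇒n>0 (Adj⇒≢ a ∘ d≡0⇒≡))

  d≡1⇒Adj : ∀ {u v} → d u v ≡ 1 → Adj G u v
  d≡1⇒Adj {u} {v} d≡1 with subst (Walk (Adj G) u v) d≡1 (proj₁ (d-Dist u v))
  ... | cons a nil = a

  d<n : ∀ u v → d u v < n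
  d<n u v with shortest-path (d-Dist u v)
  ... | M , _ , u-M , len , _ = subst (_≤ n) (cong suc len)
          (subst (length (u ∷ M) ≤_) (length-tabulate (λ x → x)) (Unique⇒length≤ u-M λ {z} _ → ∈-allFin z))

  d-via-gate : (P : Fin n → Set) (b : Fin n) → (∀ {x z} → P x → x ≢ b → Adj G x z → P z) →
               ∀ {x y} → P x → ¬ P y → d x y ≡ d x b + d b y
  d-via-gate P b P-closed {x} {y} px ¬py with Walk-via-gate P b P-closed px ¬py (proj₁ (d-Dist x y))
  ... | m₁ , m₂ , m≡ , p₁ , p₂ =
    ≤-antisym (d-triangle x b y) (subst (d x b + d b y ≤_) m≡ (+-mono-≤ (d-minimal p₁) (d-minimal p₂)))

module Unicyclic {n : ℕ} (G : Graph n) (c : List (Fin n)) (conn : Connected G)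
                 (isC : IsCycle G c) (uc : UniqueCycle G c) where
  open Adjacency G public
  open Distance G conn public
  open DecMembership (_≟F_ {n}) using () renaming (_∈?_ to _∈L?_)

  CE : Fin n → Fin n → Set
  CE = CycEdge c

  CE-sym : ∀ {u v} → CE u v → CE v u
  CE-sym (inj₁ q) = inj₂ q
  CE-sym (inj₂ q) = inj₁ q

  CE? : ∀ u v → Dec (CE u v)
  CE? u v with Consec? (close c) u v | Consec? (close c) v u
  ... | yes q | _ = yes (inj₁ q)
  ... | no _ | yes q = yes (inj₂ q)
  ... | no ¬q | no ¬q′ = no λ { (inj₁ q) → ¬q q ; (inj₂ q) → ¬q′ q }

  CE⇒∈ : ∀ {u v} → CE u v → u ∈L c × v ∈L c
  CE⇒∈ (inj₁ q) = ∈-close⁻ c (proj₁ (Consec⇒∈ q)) , ∈-close⁻ c (proj₂ (Consec⇒∈ q))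
  CE⇒∈ (inj₂ q) = ∈-close⁻ c (proj₂ (Consec⇒∈ q)) , ∈-close⁻ c (proj₁ (Consec⇒∈ q))

  cycle-Adj : ∀ {u v} → Consecutive (close c) u v → Adj G u v
  cycle-Adj {u} {v} = proj₂ (proj₂ isC) u v

  CycEdge-of-cycle : ∀ {L u v} → IsCycle G L → Consecutive (close L) u v → CE u v
  CycEdge-of-cycle {L} {u} {v} L-cycle q = proj₁ (uc L L-cycle u v) (inj₁ q)

  closed-path⇒IsCycle : ∀ {b} L → Path (Adj G) b b (b ∷ L ++ b ∷ []) → Unique (b ∷ L) → 2 ≤ length L →
                        IsCycle G (b ∷ L)
  closed-path⇒IsCycle L p u-L 2≤ = s≤s 2≤ , u-L , λ _ _ → Path-edge p

  Adj⁻ : Fin n → Fin n → Set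
  Adj⁻ = AdjMinus G c

  Adj⁻-sym : ∀ {u v} → Adj⁻ u v → Adj⁻ v u
  Adj⁻-sym (a , ¬ce) = Adj-sym a , ¬ce ∘ CE-sym

  Adj⁻? : ∀ u v → Dec (Adj⁻ u v)
  Adj⁻? u v = Adj? u v ×-dec ¬? (CE? u v)

  _~_ : Fin n → Fin n → Set
  _~_ = SameComp G c

  ~-refl : ∀ {u} → u ~ u
  ~-refl = 0 , nil

  ~-sym : ∀ {u v} → u ~ v → v ~ u
  ~-sym (k , p) = k , Walk-reverse Adj⁻-sym p

  ~-trans : ∀ {u v w} → u ~ v → v ~ w → u ~ w
  ~-trans (k , p) (l , q) = k + l , Walk-++ p q

  ~-step : ∀ {u v w} → Adj⁻ u v → v ~ w → u ~ w
  ~-step a (k , p) = suc k , cons a p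

  cycle-vertex : ∃[ v ] v ∈L c
  cycle-vertex = nonempty c (proj₁ isC)
    where
    nonempty : ∀ L → 3 ≤ length L → ∃[ v ] v ∈L L
    nonempty (v ∷ _) _ = v , here refl

  reaches-cycle : ∀ x → ∃[ r ] r ∈L c × x ~ r
  reaches-cycle x = follow (proj₂ (conn x (proj₁ cycle-vertex)))
    where
    follow : ∀ {x k} → Walk (Adj G) x (proj₁ cycle-vertex) k → ∃[ r ] r ∈L c × x ~ r
    follow nil = _ , proj₂ cycle-vertex , ~-refl
    follow {x} (cons {w = z} a p) with CE? x z
    ... | yes ce = x , proj₁ (CE⇒∈ ce) , ~-refl
    ... | no ¬ce with follow p
    ...   | r , r∈c , z~r = r , r∈c , ~-step (a , ¬ce) z~r

  module _ {X a Y b Z} (c≡ : c ≡ X ++ a ∷ Y ++ b ∷ Z) where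

    private
      c≡′ : c ≡ X ++ (a ∷ Y ++ b ∷ []) ++ Z
      c≡′ = trans c≡ (cong (λ t → X ++ a ∷ t) (sym (++-assoc Y (b ∷ []) Z)))

      arc-on-c : ∀ {u v} → Consecutive (a ∷ Y ++ b ∷ []) u v → Consecutive (close c) u v
      arc-on-c q = subst (λ t → Consecutive (close t) _ _) (sym c≡′) (Consec-++⁺ˡ (Consec-++⁺ʳ X (Consec-++⁺ˡ q)))

      arc : Path (Adj G) a b (a ∷ Y ++ b ∷ [])
      arc = build a Y λ q → cycle-Adj (arc-on-c q)
        where
        build : ∀ x W → (∀ {u v} → Consecutive (x ∷ W ++ b ∷ []) u v → Adj G u v) →
                Path (Adj G) x b (x ∷ W ++ b ∷ [])
        build x [] edge = edge here ∷ [ b ]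
        build x (y ∷ W) edge = edge here ∷ build y W (edge ∘ there)

      arc-unique : Unique (a ∷ Y ++ b ∷ [])
      arc-unique = Unique-++⁻ˡ (a ∷ Y ++ b ∷ []) (Unique-++⁻ʳ X (subst Unique c≡′ (proj₁ (proj₂ isC))))

      arc⊆c : ∀ {z} → z ∈L (a ∷ Y ++ b ∷ []) → z ∈L c
      arc⊆c m = subst (_ ∈L_) (sym c≡′) (∈-++⁺ʳ X (∈-++⁺ˡ m))

      no-direct-bridge : ∀ {w} → Adj⁻ b w → Path Adj⁻ w a (a ∷ []) → Y ≡ [] → ⊥
      no-direct-bridge b→a [ _ ] Y≡[] =
        proj₂ b→a (inj₂ (arc-on-c (subst (λ t → Consecutive (a ∷ t ++ b ∷ []) a b) (sym Y≡[]) here)))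

      2≤length : ∀ W I → (W ≡ [] → I ≡ [] → ⊥) → 2 ≤ length (W ++ b ∷ I)
      2≤length W (i ∷ I) _ = subst (2 ≤_) (sym (length-++ W)) (≤-trans (s≤s (s≤s z≤n)) (m≤n+m _ (length W)))
      2≤length (w ∷ W) [] _ = s≤s (subst (1 ≤_) (sym (length-++ W)) (m≤n+m 1 (length W)))
      2≤length [] [] ne = ⊥-elim (ne refl refl)

    -- The bridge b w … a together with the arc a … b of C would form a second cycle.
    no-bridge : ∀ {w I} → Adj⁻ b w → Path Adj⁻ w a (I ++ a ∷ []) → Unique I → (∀ {z} → z ∈L I → z ∉L c) → ⊥
    no-bridge {w} {I} b→w p u-I I∩c = proj₂ b→w (CycEdge-of-cycle L-cycle b→w-on-L)
      where
      L : List (Fin n)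
      L = a ∷ Y ++ b ∷ I

      closed : Path (Adj G) a a (L ++ a ∷ [])
      closed = subst (Path (Adj G) a a)
                 (cong (a ∷_) (trans (++-assoc Y (b ∷ []) (I ++ a ∷ [])) (sym (++-assoc Y (b ∷ I) (a ∷ [])))))
                 (Path-++ arc (Path-map proj₁ (b→w ∷ p)))

      L-unique : Unique L
      L-unique = subst Unique (cong (a ∷_) (++-assoc Y (b ∷ []) I))
                   (Unique.++⁺ arc-unique u-I λ (m₁ , m₂) → I∩c m₂ (arc⊆c m₁))

      degenerate : Y ≡ [] → I ≡ [] → ⊥
      degenerate Y≡[] I≡[] = no-direct-bridge b→w (subst (λ t → Path Adj⁻ _ a (t ++ a ∷ [])) I≡[] p) Y≡[]

      L-cycle : IsCycle G L
      L-cycle = closed-path⇒IsCycle (Y ++ b ∷ I) closed L-unique (2≤length Y I degenerate)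

      b→w-on-L : Consecutive (close L) b w
      b→w-on-L = subst (λ t → Consecutive t b w) (cong (a ∷_) (sym (++-assoc Y (b ∷ I) (a ∷ []))))
                   (Consec-++⁺ʳ (a ∷ Y) (head-edge p))
        where
        head-edge : ∀ {w K} → Path Adj⁻ w a K → Consecutive (b ∷ K) b w
        head-edge [ _ ] = here
        head-edge (_ ∷ _) = here

  private
    CrossWalk : ℕ → Set
    CrossWalk m = ∃[ x ] ∃[ y ] x ∈L c × y ∈L c × x ≢ y × Walk Adj⁻ x y m

    CrossWalk? : ∀ m → Dec (CrossWalk m)
    CrossWalk? m = any? λ x → any? λ y →
      (x ∈L? c) ×-dec (y ∈L? c) ×-dec ¬? (x ≟F y) ×-dec Walk? Adj⁻? m x y

    shortest-crossing-avoids-cycle : ∀ {u v m} → u ≢ v → v ∈L c → (∀ j → CrossWalk j → m ≤ j) →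
      Shortest {R = Adj⁻} u v m →
      ∃[ w ] ∃[ I ] Adj⁻ u w × Path Adj⁻ w v (I ++ v ∷ []) × Unique I × (∀ {z} → z ∈L I → z ∉L c)
    shortest-crossing-avoids-cycle {u} {v} {m} u≢v v∈c m-min sh with shortest-path sh
    ... | M , [ _ ] , _ = ⊥-elim (u≢v refl)
    ... | M , r ∷ p , (_ ∷ u-M) , _ , below with Path-last p
    ...   | I , refl = _ , I , r , p , Unique-++⁻ˡ I u-M , avoid
      where
      avoid : ∀ {z} → z ∈L I → z ∉L c
      avoid {z} z∈I z∈c with All.lookup below (∈-++⁺ˡ z∈I)
      ... | j , j<m , (w , _) = <⇒≱ j<m (m-min j (z , v , z∈c , v∈c , Unique-∷ʳ-∉ I u-M z∈I , w))

  cycle-separated : ∀ {x y} → x ∈L c → y ∈L c → x ~ y → x ≡ y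
  cycle-separated {x} {y} x∈c y∈c (k , p) with x ≟F y
  ... | yes x≡y = x≡y
  ... | no x≢y with find-least CrossWalk? k (x , y , x∈c , y∈c , x≢y , p)
  ...   | least m (a , b , a∈c , b∈c , a≢b , w) m-min = ⊥-elim (split (∈-∃++ a∈c))
    where
    sh : Shortest {R = Adj⁻} a b m
    sh = w , λ j q → m-min j (a , b , a∈c , b∈c , a≢b , q)

    split : (∃[ X ] ∃[ R ] c ≡ X ++ a ∷ R) → ⊥
    split (X , R , c≡) with ∈-++⁻ X (subst (b ∈L_) c≡ b∈c)
    ... | inj₁ b∈X with ∈-∃++ b∈X
    ...   | X₁ , Y , refl with shortest-crossing-avoids-cycle a≢b b∈c m-min sh
    ...     | _ , I , a→w , path , u-I , I∩c = no-bridge (trans c≡ (++-assoc X₁ (b ∷ Y) (a ∷ R))) a→w path u-I I∩c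
    split (X , R , c≡) | inj₂ (here b≡a) = a≢b (sym b≡a)
    split (X , R , c≡) | inj₂ (there b∈R) with ∈-∃++ b∈R
    ... | Y , Z , refl with shortest-crossing-avoids-cycle (a≢b ∘ sym) a∈c m-min (Shortest-reverse Adj⁻-sym sh)
    ...   | _ , I , b→w , path , u-I , I∩c = no-bridge c≡ b→w path u-I I∩c

  S-outside-component : ∀ {S} → AtLeastTwoActive G c S → ∀ {r} → r ∈L c → ∃[ s ] s ∈ S × ¬ (s ~ r)
  S-outside-component (v , w , v≢w , (v∈c , s , s∈S , v~s) , (w∈c , t , t∈S , w~t)) {r} r∈c with v ≟F r
  ... | no v≢r = s , s∈S , λ s~r → v≢r (cycle-separated v∈c r∈c (~-trans v~s s~r))
  ... | yes refl = t , t∈S , λ t~r → v≢w (sym (cycle-separated w∈c r∈c (~-trans w~t t~r)))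

module RootedTree {n : ℕ} (G : Graph n) (c : List (Fin n)) (conn : Connected G)
                  (isC : IsCycle G c) (uc : UniqueCycle G c) (r : Fin n) (r∈c : r ∈L c) where
  open Unicyclic G c conn isC uc public

  InT : Fin n → Set
  InT x = x ~ r

  h : Fin n → ℕ
  h x = d x r

  h-root : h r ≡ 0
  h-root = d-refl r

  h≡0⇒root : ∀ {x} → h x ≡ 0 → x ≡ r
  h≡0⇒root = d≡0⇒≡

  h≡suc⇒≢root : ∀ {x k} → h x ≡ suc k → x ≢ r
  h≡suc⇒≢root hx refl = 0≢1+n (trans (sym h-root) hx)

  h-Adj : ∀ {x y} → Adj G x y → h x ≤ suc (h y)
  h-Adj = d-Adj-≤ r

  InT∩cycle⇒root : ∀ {x} → InT x → x ∈L c → x ≡ r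
  InT∩cycle⇒root tx x∈c = cycle-separated x∈c r∈c tx

  InT-Adj⁻ : ∀ {x y} → InT x → x ≢ r → Adj G x y → Adj⁻ x y
  InT-Adj⁻ tx x≢r a = a , λ ce → x≢r (InT∩cycle⇒root tx (proj₁ (CE⇒∈ ce)))

  InT-closed : ∀ {x y} → InT x → x ≢ r → Adj G x y → InT y
  InT-closed tx x≢r a = ~-trans (~-step (Adj⁻-sym (InT-Adj⁻ tx x≢r a)) ~-refl) tx

  InT? : ∀ y → Dec (InT y)
  InT? y with reaches-cycle y
  ... | r′ , r′∈c , y~r′ with r′ ≟F r
  ...   | yes refl = yes y~r′
  ...   | no r′≢r = no λ ty → r′≢r (cycle-separated r′∈c r∈c (~-trans (~-sym y~r′) ty))

  parent : ∀ {x k} → InT x → h x ≡ suc k → ∃[ p ] Adj G x p × h p ≡ k × InT p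
  parent tx hx with d-step hx
  ... | p , a , hp = p , a , hp , InT-closed tx (h≡suc⇒≢root hx) a

  -- Descending from a and b until their ancestors meet closes the path into a cycle, which must be C.
  upper-path-on-cycle : ∀ k {a b W u v} → InT a → InT b → h a ≡ k → h b ≡ k → a ≢ b →
    Path (Adj G) b a W → Unique W → All (λ z → k ≤ h z) W → Consecutive W u v → CE u v
  upper-path-on-cycle zero _ _ ha hb a≢b _ _ _ _ = ⊥-elim (a≢b (trans (h≡0⇒root ha) (sym (h≡0⇒root hb))))
  upper-path-on-cycle (suc k) {a} {b} {W} ta tb ha hb a≢b p u-W W-high q with parent ta ha | parent tb hb
  ... | pa , a→pa , hpa , tpa | pb , b→pb , hpb , tpb with pa ≟F pb
  ...   | no pa≢pb =
    upper-path-on-cycle k tpa tpb hpa hpb pa≢pb (Adj-sym b→pb ∷ Path-∷ʳ p a→pa)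
      (All.++⁺ (All.tabulate λ m pb≡z → not-in-W (subst (_∈L W) (sym pb≡z) m) hpb) ((pa≢pb ∘ sym) ∷ [])
        ∷ Unique-∷ʳ u-W (λ m → not-in-W m hpa))
      (≤-reflexive (sym hpb) ∷ All.++⁺ (All.map (≤-trans (n≤1+n k)) W-high) (≤-reflexive (sym hpa) ∷ []))
      (there (Consec-++⁺ˡ q))
    where
    not-in-W : ∀ {z} → z ∈L W → h z ≡ k → ⊥
    not-in-W m hz = <-irrefl (sym hz) (All.lookup W-high m)
  ...   | yes refl with Path-head p
  ...     | W′ , refl = CycEdge-of-cycle closed (Consec-++⁺ˡ (Consec-++⁺ˡ q))
    where
    pa∉W : pa ∉L W
    pa∉W m = <-irrefl (sym hpa) (All.lookup W-high m)
    2≤length : 2 ≤ length (W′ ++ pa ∷ [])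
    2≤length = subst (2 ≤_) (sym (trans (length-++ W′) (+-comm (length W′) 1)))
                 (s≤s (≤-pred (Path-length p (a≢b ∘ sym))))
    closed : IsCycle G (b ∷ W′ ++ pa ∷ [])
    closed = closed-path⇒IsCycle (W′ ++ pa ∷ []) (Path-∷ʳ (Path-∷ʳ p a→pa) (Adj-sym b→pb))
               (Unique-∷ʳ u-W pa∉W) 2≤length

  Adj⇒h≢ : ∀ {x y} → InT x → InT y → Adj G x y → h x ≢ h y
  Adj⇒h≢ {x} {y} tx ty x→y hx≡hy = Adj⇒≢ x→y (trans x≡r (sym y≡r))
    where
    y→x-on-C : CE y x
    y→x-on-C = upper-path-on-cycle (h x) tx ty refl (sym hx≡hy) (Adj⇒≢ x→y) (Adj-sym x→y ∷ [ x ])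
                 (((Adj⇒≢ x→y ∘ sym) ∷ []) ∷ [] ∷ []) (≤-reflexive hx≡hy ∷ ≤-refl ∷ []) here
    x≡r : x ≡ r
    x≡r = InT∩cycle⇒root tx (proj₂ (CE⇒∈ y→x-on-C))
    y≡r : y ≡ r
    y≡r = h≡0⇒root (trans (sym hx≡hy) (trans (cong h x≡r) h-root))

  parent-unique : ∀ {x p q k} → InT x → Adj G x p → Adj G x q → h p ≡ k → h q ≡ k → h x ≡ suc k → p ≡ q
  parent-unique {x} {p} {q} {k} tx x→p x→q hp hq hx with p ≟F q
  ... | yes p≡q = p≡q
  ... | no p≢q = ⊥-elim (x≢r (InT∩cycle⇒root tx (proj₂ (CE⇒∈ q→x-on-C))))
    where
    x≢r : x ≢ r
    x≢r = h≡suc⇒≢root hx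
    q→x-on-C : CE q x
    q→x-on-C = upper-path-on-cycle k (InT-closed tx x≢r x→p) (InT-closed tx x≢r x→q) hp hq p≢q
                 (Adj-sym x→q ∷ x→p ∷ [ p ])
                 (((Adj⇒≢ x→q ∘ sym) ∷ (p≢q ∘ sym) ∷ []) ∷ (Adj⇒≢ x→p ∷ []) ∷ [] ∷ [])
                 (≤-reflexive (sym hq) ∷ subst (k ≤_) (sym hx) (n≤1+n k) ∷ ≤-reflexive (sym hp) ∷ []) here

  neighbour-parent-or-child : ∀ {a p y k} → InT a → h a ≡ suc k → Adj G a p → h p ≡ k → Adj G a y →
                              y ≡ p ⊎ h y ≡ suc (h a)
  neighbour-parent-or-child {a} {p} {y} {k} ta ha a→p hp a→y with <-cmp (h y) (h a)
  ... | tri≈ _ hy≡ha _ = ⊥-elim (Adj⇒h≢ ta (InT-closed ta (h≡suc⇒≢root ha) a→y) a→y (sym hy≡ha))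
  ... | tri> _ _ hy>ha = inj₂ (≤-antisym (h-Adj (Adj-sym a→y)) hy>ha)
  ... | tri< hy<ha _ _ = inj₁ (sym (parent-unique ta a→p a→y hp hy ha))
    where
    hy : h y ≡ k
    hy = suc-injective (trans (sym (≤-antisym (h-Adj a→y) hy<ha)) ha)

  -- Desc b y: y lies in the subtree of T rooted at b, i.e. some shortest path from y to r passes b.
  Desc : Fin n → Fin n → Set
  Desc b y = InT y × h y ≡ d y b + h b

  Desc? : ∀ b y → Dec (Desc b y)
  Desc? b y = InT? y ×-dec (h y ≟ d y b + h b)

  Desc-refl : ∀ {b} → InT b → Desc b b
  Desc-refl {b} tb = tb , cong (_+ h b) (sym (d-refl b))

  Desc⇒h≥ : ∀ {b x} → Desc b x → h b ≤ h x
  Desc⇒h≥ {b} {x} (_ , hx) = subst (h b ≤_) (sym hx) (m≤n+m (h b) (d x b))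

  Desc-h≡⇒≡ : ∀ {b x} → Desc b x → h x ≡ h b → x ≡ b
  Desc-h≡⇒≡ {b} {x} (_ , hx) hx≡hb = d≡0⇒≡ (+-cancelʳ-≡ (h b) (d x b) 0 (trans (sym hx) hx≡hb))

  Desc-trans : ∀ {a b x} → Desc a b → Desc b x → Desc a x
  Desc-trans {a} {b} {x} (_ , hb) (tx , hx) = tx , ≤-antisym (d-triangle x a r) (begin
    d x a + h a         ≤⟨ +-monoˡ-≤ (h a) (d-triangle x b a) ⟩
    d x b + d b a + h a ≡⟨ +-assoc (d x b) (d b a) (h a) ⟩
    d x b + (d b a + h a) ≡⟨ cong (d x b +_) hb ⟨
    d x b + h b         ≡⟨ hx ⟨
    h x                 ∎)
    where
    open ≤-Reasoning

  child⇒Desc : ∀ {u p k} → InT u → Adj G u p → h u ≡ suc k → h p ≡ k → Desc p u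
  child⇒Desc {u} {p} tu u→p hu hp = tu , trans hu (sym (cong₂ _+_ (Adj⇒d≡1 u→p) hp))

  Desc-parent : ∀ {b s} → Desc b s → s ≢ b → ∃[ p ] Adj G s p × Desc b p × h s ≡ suc (h p)
  Desc-parent {b} {s} (ts , hs) s≢b with d s b in ds
  ... | zero = ⊥-elim (s≢b (d≡0⇒≡ ds))
  ... | suc j with d-step ds
  ...   | p , s→p , dp = p , s→p , (InT-closed ts s≢r s→p , hp′) , trans hs (cong suc (sym hp))
    where
    s≢r : s ≢ r
    s≢r refl = 0≢1+n (trans (sym h-root) hs)
    hp : h p ≡ j + h b
    hp = ≤-antisym (subst (λ t → h p ≤ t + h b) dp (d-triangle p b r))
                   (≤-pred (subst (_≤ suc (h p)) hs (h-Adj s→p)))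
    hp′ : h p ≡ d p b + h b
    hp′ = trans hp (cong (_+ h b) (sym dp))

  Desc-closed : ∀ {b x z} → Desc b x → x ≢ b → Adj G x z → Desc b z
  Desc-closed {b} {x} {z} (tx , hx) x≢b x→z with Desc-parent (tx , hx) x≢b
  ... | p , x→p , Desc-b-p , hx≡ with <-cmp (h x) (h z)
  ...   | tri≈ _ hx≡hz _ = ⊥-elim (Adj⇒h≢ tx (InT-closed tx (h≡suc⇒≢root hx≡) x→z) x→z hx≡hz)
  ...   | tri< hx<hz _ _ = InT-closed tx (h≡suc⇒≢root hx≡) x→z , ≤-antisym (d-triangle z b r) (begin
    d z b + h b         ≤⟨ +-monoˡ-≤ (h b) (d-Adj-≤ b (Adj-sym x→z)) ⟩
    suc (d x b + h b)   ≡⟨ cong suc hx ⟨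
    suc (h x)           ≡⟨ ≤-antisym (h-Adj (Adj-sym x→z)) hx<hz ⟨
    h z                 ∎)
    where
    open ≤-Reasoning
  ...   | tri> _ _ hz<hx = subst (Desc b) p≡z Desc-b-p
    where
    hx≡′ : h x ≡ suc (h z)
    hx≡′ = ≤-antisym (h-Adj x→z) hz<hx
    p≡z : p ≡ z
    p≡z = parent-unique tx x→p x→z (suc-injective (trans (sym hx≡) hx≡′)) refl hx≡′

  common-descendant⇒≡ : ∀ j {u v s} → d s u ≡ j → Desc u s → Desc v s → h u ≡ h v → u ≡ v
  common-descendant⇒≡ zero ds Desc-u-s Desc-v-s hu≡hv with d≡0⇒≡ ds
  ... | refl = Desc-h≡⇒≡ Desc-v-s hu≡hv
  common-descendant⇒≡ (suc j) {u} {v} {s} ds Desc-u-s Desc-v-s hu≡hv with s ≟F v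
  ... | yes refl = sym (Desc-h≡⇒≡ Desc-u-s (sym hu≡hv))
  ... | no s≢v with Desc-parent Desc-u-s (λ { refl → 0≢1+n (trans (sym (d-refl s)) ds) })
                  | Desc-parent Desc-v-s s≢v
  ...   | p , s→p , Desc-u-p , hs≡ | q , s→q , Desc-v-q , hs≡′ =
    common-descendant⇒≡ j dp Desc-u-p (subst (Desc v) (sym p≡q) Desc-v-q) hu≡hv
    where
    p≡q : p ≡ q
    p≡q = parent-unique (proj₁ Desc-u-s) s→p s→q refl (suc-injective (trans (sym hs≡′) hs≡)) hs≡
    dp : d p u ≡ j
    dp = +-cancelʳ-≡ (h u) (d p u) j (suc-injective (begin
      suc (d p u + h u) ≡⟨ cong suc (proj₂ Desc-u-p) ⟨
      suc (h p)         ≡⟨ hs≡ ⟨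
      h s               ≡⟨ proj₂ Desc-u-s ⟩
      d s u + h u       ≡⟨ cong (_+ h u) ds ⟩
      suc j + h u       ∎))
      where
      open ≡-Reasoning

  d-leaving-T : ∀ {x y} → InT x → ¬ InT y → d x y ≡ h x + d r y
  d-leaving-T = d-via-gate InT r λ tx x≢r → InT-closed tx x≢r

  d-leaving-Desc : ∀ {b x y} → Desc b x → ¬ Desc b y → d x y ≡ d x b + d b y
  d-leaving-Desc {b} = d-via-gate (Desc b) b Desc-closed

  -- w is the lowest common ancestor of u and v, and u′, v′ its children towards u and v.
  record Fork (u v : Fin n) : Set where
    field
      w u′ v′   : Fin n
      w→u′      : Adj G w u′
      w→v′      : Adj G w v′
      hu′       : h u′ ≡ suc (h w)
      hv′       : h v′ ≡ suc (h w)
      u′≢v′     : u′ ≢ v′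
      Desc-u′-u : Desc u′ u
      Desc-v′-v : Desc v′ v
      tw        : InT w
      tu′       : InT u′
      tv′       : InT v′

  Fork-swap : ∀ {u v} → Fork u v → Fork v u
  Fork-swap f = record
    { w = w ; u′ = v′ ; v′ = u′ ; w→u′ = w→v′ ; w→v′ = w→u′ ; hu′ = hv′ ; hv′ = hu′
    ; u′≢v′ = u′≢v′ ∘ sym ; Desc-u′-u = Desc-v′-v ; Desc-v′-v = Desc-u′-u ; tw = tw ; tu′ = tv′ ; tv′ = tu′ }
    where
    open Fork f

  fork : ∀ k {u v} → InT u → InT v → h u ≡ k → h v ≡ k → u ≢ v → Fork u v
  fork zero _ _ hu hv u≢v = ⊥-elim (u≢v (trans (h≡0⇒root hu) (sym (h≡0⇒root hv))))
  fork (suc k) {u} {v} tu tv hu hv u≢v with parent tu hu | parent tv hv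
  ... | pu , u→pu , hpu , tpu | pv , v→pv , hpv , tpv with pu ≟F pv
  ...   | yes refl = record
    { w = pu ; u′ = u ; v′ = v ; w→u′ = Adj-sym u→pu ; w→v′ = Adj-sym v→pv
    ; hu′ = trans hu (cong suc (sym hpu)) ; hv′ = trans hv (cong suc (sym hpv)) ; u′≢v′ = u≢v
    ; Desc-u′-u = Desc-refl tu ; Desc-v′-v = Desc-refl tv ; tw = tpu ; tu′ = tu ; tv′ = tv }
  ...   | no pu≢pv = record
    { w = w ; u′ = u′ ; v′ = v′ ; w→u′ = w→u′ ; w→v′ = w→v′ ; hu′ = hu′ ; hv′ = hv′ ; u′≢v′ = u′≢v′
    ; Desc-u′-u = Desc-trans Desc-u′-u (child⇒Desc tu u→pu hu hpu)
    ; Desc-v′-v = Desc-trans Desc-v′-v (child⇒Desc tv v→pv hv hpv) ; tw = tw ; tu′ = tu′ ; tv′ = tv′ }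
    where
    open Fork (fork k tpu tpv hpu hpv pu≢pv)

  module ForkDistances {u v} (f : Fork u v) where
    open Fork f

    private
      hu′≡hv′ : h u′ ≡ h v′
      hu′≡hv′ = trans hu′ (sym hv′)

      ¬Desc-v′ : ∀ {s} → Desc u′ s → ¬ Desc v′ s
      ¬Desc-v′ Desc-u′-s Desc-v′-s = u′≢v′ (common-descendant⇒≡ _ refl Desc-u′-s Desc-v′-s hu′≡hv′)

      2≤d-u′-v′ : 2 ≤ d u′ v′
      2≤d-u′-v′ with d u′ v′ in duv
      ... | zero = ⊥-elim (u′≢v′ (d≡0⇒≡ duv))
      ... | suc zero = ⊥-elim (Adj⇒h≢ tu′ tv′ (d≡1⇒Adj duv) hu′≡hv′)
      ... | suc (suc _) = s≤s (s≤s z≤n)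

      d-across : ∀ {s y} → Desc u′ s → Desc v′ y → d y s ≡ d y v′ + (d s u′ + d u′ v′)
      d-across {s} {y} Desc-u′-s Desc-v′-y =
        trans (d-leaving-Desc Desc-v′-y (¬Desc-v′ Desc-u′-s))
              (cong (d y v′ +_) (trans (d-sym v′ s)
                (d-leaving-Desc Desc-u′-s λ Desc-u′-v′ → u′≢v′ (sym (Desc-h≡⇒≡ Desc-u′-v′ (sym hu′≡hv′))))))

      d-within : ∀ s x → d x s ≤ d x u′ + d s u′
      d-within s x = subst (λ t → d x s ≤ d x u′ + t) (d-sym u′ s) (d-triangle x u′ s)

      d-to-w : ∀ {s} → Desc u′ s → d w s ≡ suc (d s u′)
      d-to-w {s} Desc-u′-s = begin
        d w s             ≡⟨ d-sym w s ⟩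
        d s w             ≡⟨ d-leaving-Desc Desc-u′-s ¬Desc-u′-w ⟩
        d s u′ + d u′ w   ≡⟨ cong (d s u′ +_) (Adj⇒d≡1 (Adj-sym w→u′)) ⟩
        d s u′ + 1        ≡⟨ +-comm (d s u′) 1 ⟩
        suc (d s u′)      ∎
        where
        open ≡-Reasoning
        ¬Desc-u′-w : ¬ Desc u′ w
        ¬Desc-u′-w Desc-u′-w = <-irrefl refl (subst (_≤ h w) hu′ (Desc⇒h≥ Desc-u′-w))

      same-depth : ∀ {x y} → Desc u′ x → Desc v′ y → h x ≡ h y → d x u′ ≡ d y v′
      same-depth {x} {y} (_ , hx) (_ , hy) hx≡hy =
        +-cancelʳ-≡ (h v′) (d x u′) (d y v′)
          (trans (cong (d x u′ +_) (sym hu′≡hv′)) (trans (sym hx) (trans hx≡hy hy)))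

    closer-in-own-branch : ∀ {s x y} → Desc u′ s → Desc u′ x → Desc v′ y → h x ≡ h y → d x s < d y s
    closer-in-own-branch {s} {x} {y} Desc-u′-s Desc-u′-x Desc-v′-y hx≡hy = begin-strict
      d x s                             ≤⟨ d-within s x ⟩
      d x u′ + d s u′                   ≡⟨ cong (_+ d s u′) (same-depth Desc-u′-x Desc-v′-y hx≡hy) ⟩
      d y v′ + d s u′                   <⟨ ≤-trans (n≤1+n _) (2+m+n≤m+[n+k] (d y v′) (d s u′) 2≤d-u′-v′) ⟩
      d y v′ + (d s u′ + d u′ v′)       ≡⟨ d-across Desc-u′-s Desc-v′-y ⟨
      d y s                             ∎
      where
      open ≤-Reasoning

    closer-than-parent-in-other-branch : ∀ {s x y py} → Desc u′ s → Desc u′ x → Desc v′ y → h x ≡ h y →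
      Adj G y py → h y ≡ suc (h py) → d x s < d py s
    closer-than-parent-in-other-branch {s} {x} {y} {py} Desc-u′-s Desc-u′-x Desc-v′-y hx≡hy y→py hy with y ≟F v′
    ... | yes refl = begin-strict
      d x s             ≤⟨ d-within s x ⟩
      d x u′ + d s u′   ≡⟨ cong (_+ d s u′) (trans (same-depth Desc-u′-x Desc-v′-y hx≡hy) (d-refl y)) ⟩
      d s u′            <⟨ n<1+n (d s u′) ⟩
      suc (d s u′)      ≡⟨ d-to-w Desc-u′-s ⟨
      d w s             ≡⟨ cong (λ t → d t s) py≡w ⟨
      d py s            ∎
      where
      open ≤-Reasoning
      py≡w : py ≡ w
      py≡w = parent-unique (proj₁ Desc-v′-y) y→py (Adj-sym w→v′) refl (suc-injective (trans (sym hv′) hy)) hy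
    ... | no y≢v′ with Desc-parent Desc-v′-y y≢v′
    ...   | p , y→p , Desc-v′-p , hy≡ = begin-strict
      d x s                              ≤⟨ d-within s x ⟩
      d x u′ + d s u′                    ≡⟨ cong (_+ d s u′) dxu′ ⟩
      suc (d py v′ + d s u′)             <⟨ 2+m+n≤m+[n+k] (d py v′) (d s u′) 2≤d-u′-v′ ⟩
      d py v′ + (d s u′ + d u′ v′)       ≡⟨ d-across Desc-u′-s Desc-v′-py ⟨
      d py s                             ∎
      where
      open ≤-Reasoning
      Desc-v′-py : Desc v′ py
      Desc-v′-py = subst (Desc v′) p≡py Desc-v′-p
        where
        p≡py : p ≡ py
        p≡py = parent-unique (proj₁ Desc-v′-y) y→p y→py refl (suc-injective (trans (sym hy) hy≡)) hy≡
      dxu′ : d x u′ ≡ suc (d py v′)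
      dxu′ = trans (same-depth Desc-u′-x Desc-v′-y hx≡hy)
               (+-cancelʳ-≡ (h v′) _ _ (trans (sym (proj₂ Desc-v′-y)) (trans hy (cong suc (proj₂ Desc-v′-py)))))

module Resolving {n : ℕ} (G : Graph n) (c : List (Fin n)) (conn : Connected G)
                 (isC : IsCycle G c) (uc : UniqueCycle G c) (r : Fin n) (r∈c : r ∈L c)
                 (S : Subset n) (br : BranchResolving G S) where
  open RootedTree G c conn isC uc r r∈c public

  Free : Fin n → Set
  Free a = ∀ y → Desc a y → y ∉ S

  record ThreadBelow (a : Fin n) : Set where
    field
      rest        : List (Fin n)
      unique      : Unique (a ∷ rest)
      linked      : Linked (Adj G) (a ∷ rest)
      descendants : All (Desc a) (a ∷ rest)
      ends        : ∃[ ini ] ∃[ uₖ ] (a ∷ rest ≡ ini ++ uₖ ∷ [] × All (λ x → deg G x ≡ 2) ini × deg G uₖ ≡ 1)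

  free-threads-equal : ∀ {v a b} → 3 ≤ deg G v → Adj G v a → Adj G v b → Free a → Free b →
                       ThreadBelow a → ThreadBelow b → a ≡ b
  free-threads-equal {v} {a} {b} 3≤deg v→a v→b free-a free-b ta tb =
    ∷-injectiveˡ (br v 3≤deg _ _ (thread v→a ta) (thread v→b tb) (avoids-S free-a ta) (avoids-S free-b tb))
    where
    open ThreadBelow
    thread : ∀ {x} → Adj G v x → (t : ThreadBelow x) → Thread G v (x ∷ rest t)
    thread {x} v→x t = unique t , linked t , 3≤deg , (x , rest t , refl , v→x) , ends t
    avoids-S : ∀ {x} → Free x → (t : ThreadBelow x) → All (_∉ S) (x ∷ rest t)
    avoids-S free-x t = All.map (free-x _) (descendants t)

  Child : Fin n → Fin n → Set
  Child a y = Adj G a y × h y ≡ suc (h a)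

  Child? : ∀ a y → Dec (Child a y)
  Child? a y = Adj? a y ×-dec (h y ≟ suc (h a))

  parent≢child : ∀ {a p y k} → h a ≡ suc k → h p ≡ k → Child a y → p ≢ y
  parent≢child ha hp (_ , hy) refl = <⇒≢ (m<n⇒m<1+n (n<1+n _)) (trans (sym hp) (trans hy (cong suc ha)))

  leaf-thread : ∀ {a} → InT a → deg G a ≡ 1 → ThreadBelow a
  leaf-thread ta deg≡1 = record
    { rest = [] ; unique = [] ∷ [] ; linked = [-] ; descendants = Desc-refl ta ∷ []
    ; ends = [] , _ , refl , [] , deg≡1 }

  extend-thread : ∀ {a y} → InT a → deg G a ≡ 2 → Child a y → ThreadBelow y → ThreadBelow a
  extend-thread {a} {y} ta deg≡2 (a→y , hy) t = record
    { rest = y ∷ rest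
    ; unique = All.map (λ Desc-y-z a≡z → <-irrefl (cong h a≡z) (below Desc-y-z)) descendants ∷ unique
    ; linked = a→y ∷ linked
    ; descendants = Desc-refl ta ∷ All.map (Desc-trans Desc-a-y) descendants
    ; ends = let ini , uₖ , y∷rest≡ , ini-deg , uₖ-deg = ends
             in a ∷ ini , uₖ , cong (a ∷_) y∷rest≡ , deg≡2 ∷ ini-deg , uₖ-deg }
    where
    open ThreadBelow t
    Desc-a-y : Desc a y
    Desc-a-y = child⇒Desc (proj₁ (All.head descendants)) (Adj-sym a→y) hy refl
    below : ∀ {z} → Desc y z → h a < h z
    below Desc-y-z = <-≤-trans (subst (h a <_) (sym hy) (n<1+n (h a))) (Desc⇒h≥ Desc-y-z)

  -- A vertex with two children would carry two S-free threads, contradicting branch resolution.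
  thread-below : ∀ fuel {a k} → n ≤ h a + fuel → InT a → h a ≡ suc k → Free a → ThreadBelow a
  thread-below zero {a} n≤ _ _ _ = ⊥-elim (<⇒≱ (d<n a r) (subst (n ≤_) (+-identityʳ (h a)) n≤))
  thread-below (suc fuel) {a} {k} n≤ ta ha free with parent ta ha
  ... | p , a→p , hp , _ = by-children (any? (Child? a))
    where
    child-Desc : ∀ {y} → Child a y → Desc a y
    child-Desc (a→y , hy) = child⇒Desc (InT-closed ta (h≡suc⇒≢root ha) a→y) (Adj-sym a→y) hy refl

    child-free : ∀ {y} → Child a y → Free y
    child-free child z = free z ∘ Desc-trans (child-Desc child)

    below : ∀ {y} → Child a y → ThreadBelow y
    below child@(_ , hy) =
      thread-below fuel (subst (n ≤_) (trans (+-suc (h a) fuel) (cong (_+ fuel) (sym hy))) n≤)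
        (proj₁ (child-Desc child)) hy (child-free child)

    by-children : Dec (∃ (Child a)) → ThreadBelow a
    by-children (no no-child) =
      leaf-thread ta (≤-antisym (deg-≤ (p ∷ []) only-parent) (deg-≥ (p ∷ []) ([] ∷ []) λ { (here refl) → a→p }))
      where
      only-parent : ∀ {y} → Adj G a y → y ∈L p ∷ []
      only-parent {y} a→y with neighbour-parent-or-child ta ha a→p hp a→y
      ... | inj₁ y≡p = here y≡p
      ... | inj₂ hy = ⊥-elim (no-child (y , a→y , hy))
    by-children (yes (y₁ , child₁)) with any? (λ y → Child? a y ×-dec ¬? (y ≟F y₁))
    ... | yes (y₂ , child₂ , y₂≢y₁) =
      ⊥-elim (y₂≢y₁ (sym (free-threads-equal 3≤deg (proj₁ child₁) (proj₁ child₂)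
                            (child-free child₁) (child-free child₂) (below child₁) (below child₂))))
      where
      3≤deg : 3 ≤ deg G a
      3≤deg = deg-≥ (p ∷ y₁ ∷ y₂ ∷ [])
                ((parent≢child ha hp child₁ ∷ parent≢child ha hp child₂ ∷ []) ∷ ((y₂≢y₁ ∘ sym) ∷ []) ∷ [] ∷ [])
                λ { (here refl) → a→p
                  ; (there (here refl)) → proj₁ child₁
                  ; (there (there (here refl))) → proj₁ child₂ }
    ... | no no-other = extend-thread ta deg≡2 child₁ (below child₁)
      where
      parent-or-y₁ : ∀ {y} → Adj G a y → y ∈L p ∷ y₁ ∷ []
      parent-or-y₁ {y} a→y with neighbour-parent-or-child ta ha a→p hp a→y
      ... | inj₁ y≡p = here y≡p
      ... | inj₂ hy with y ≟F y₁
      ...   | yes y≡y₁ = there (here y≡y₁)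
      ...   | no y≢y₁ = ⊥-elim (no-other (y , (a→y , hy) , y≢y₁))
      deg≡2 : deg G a ≡ 2
      deg≡2 = ≤-antisym (deg-≤ (p ∷ y₁ ∷ []) parent-or-y₁)
                (deg-≥ (p ∷ y₁ ∷ []) ((parent≢child ha hp child₁ ∷ []) ∷ [] ∷ [])
                  λ { (here refl) → a→p ; (there (here refl)) → proj₁ child₁ })

  MeetsS : Fin n → Set
  MeetsS b = ∃[ s ] s ∈ S × Desc b s

  MeetsS? : ∀ b → Dec (MeetsS b)
  MeetsS? b = any? λ s → (s Subset.∈? S) ×-dec Desc? b s

  ¬MeetsS⇒Free : ∀ {b} → ¬ MeetsS b → Free b
  ¬MeetsS⇒Free ¬meets s Desc-b-s s∈S = ¬meets (s , s∈S , Desc-b-s)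

  fork-branches : ∀ {u v} (f : Fork u v) → 3 ≤ deg G (Fork.w f)
  fork-branches f = three-neighbours third-neighbour
    where
    open Fork f
    three-neighbours : ∃[ z ] Adj G w z × z ≢ u′ × z ≢ v′ → 3 ≤ deg G w
    three-neighbours (z , w→z , z≢u′ , z≢v′) =
      deg-≥ (z ∷ u′ ∷ v′ ∷ []) ((z≢u′ ∷ z≢v′ ∷ []) ∷ (u′≢v′ ∷ []) ∷ [] ∷ [])
      λ { (here refl) → w→z ; (there (here refl)) → w→u′ ; (there (there (here refl))) → w→v′ }
    third-neighbour : ∃[ z ] Adj G w z × z ≢ u′ × z ≢ v′
    third-neighbour with h w in hw
    ... | suc k with parent tw hw
    ...   | p , w→p , hp , _ = p , w→p , parent≢child hw hp (w→u′ , hu′) , parent≢child hw hp (w→v′ , hv′)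
    third-neighbour | zero with h≡0⇒root hw
    ... | refl with close-successor c r∈c
    ...   | z , q = z , cycle-Adj q , off-cycle tu′ hu′ , off-cycle tv′ hv′
      where
      z∈c : z ∈L c
      z∈c = ∈-close⁻ c (proj₂ (Consec⇒∈ q))
      off-cycle : ∀ {x} → InT x → h x ≡ suc (h w) → z ≢ x
      off-cycle tx hx refl = h≡suc⇒≢root hx (InT∩cycle⇒root tx z∈c)

  fork-meets-S : ∀ {u v} (f : Fork u v) → MeetsS (Fork.u′ f) ⊎ MeetsS (Fork.v′ f)
  fork-meets-S f with MeetsS? (Fork.u′ f) | MeetsS? (Fork.v′ f)
  ... | yes meets-u′ | _ = inj₁ meets-u′
  ... | no _ | yes meets-v′ = inj₂ meets-v′
  ... | no ¬meets-u′ | no ¬meets-v′ = ⊥-elim (u′≢v′ (free-threads-equal (fork-branches f) w→u′ w→v′ free-u′ free-v′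
          (thread-below n (m≤n+m n (h u′)) tu′ hu′ free-u′) (thread-below n (m≤n+m n (h v′)) tv′ hv′ free-v′)))
    where
    open Fork f
    free-u′ : Free u′
    free-u′ = ¬MeetsS⇒Free ¬meets-u′
    free-v′ : Free v′
    free-v′ = ¬MeetsS⇒Free ¬meets-v′

  Oriented : Fin n → Fin n → Set
  Oriented a b = ∃[ ch ] ∃[ pa ] SameEdge a b ch pa × Adj G ch pa × h ch ≡ suc (h pa) × InT ch

  orient : ∀ {a b} → InT a → InT b → Adj G a b → Oriented a b
  orient {a} {b} ta tb a→b with <-cmp (h a) (h b)
  ... | tri≈ _ ha≡hb _ = ⊥-elim (Adj⇒h≢ ta tb a→b ha≡hb)
  ... | tri< ha<hb _ _ = b , a , inj₂ (refl , refl) , Adj-sym a→b , ≤-antisym (h-Adj (Adj-sym a→b)) ha<hb , tb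
  ... | tri> _ _ hb<ha = a , b , inj₁ (refl , refl) , a→b , ≤-antisym (h-Adj a→b) hb<ha , ta

  module Separation (active : AtLeastTwoActive G c S) where
    private
      outside : ∃[ s ] s ∈ S × ¬ InT s
      outside = S-outside-component active r∈c
      s₀ : Fin n
      s₀ = proj₁ outside
      s₀∈S : s₀ ∈ S
      s₀∈S = proj₁ (proj₂ outside)
      s₀∉T : ¬ InT s₀
      s₀∉T = proj₂ (proj₂ outside)

    h-seen-from-outside : ∀ {u v} → InT u → InT v → d u s₀ ≡ d v s₀ → h u ≡ h v
    h-seen-from-outside {u} {v} tu tv du≡dv = +-cancelʳ-≡ (d r s₀) (h u) (h v)
      (trans (sym (d-leaving-T tu s₀∉T)) (trans du≡dv (d-leaving-T tv s₀∉T)))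

    edge-distance-from-outside : ∀ {ch pa} → InT ch → Adj G ch pa → h ch ≡ suc (h pa) →
                                 d ch s₀ ⊓ d pa s₀ ≡ d pa s₀
    edge-distance-from-outside {ch} {pa} tch ch→pa hch = m≥n⇒m⊓n≡n (begin
      d pa s₀         ≡⟨ d-leaving-T (InT-closed tch (h≡suc⇒≢root hch) ch→pa) s₀∉T ⟩
      h pa + d r s₀   ≤⟨ +-monoˡ-≤ (d r s₀) (subst (h pa ≤_) (sym hch) (n≤1+n (h pa))) ⟩
      h ch + d r s₀   ≡⟨ d-leaving-T tch s₀∉T ⟨
      d ch s₀         ∎)
      where
      open ≤-Reasoning

    vertices-distinguished : ∀ {u v} → InT u → InT v → u ≢ v → ∃[ s ] s ∈ S × d u s ≢ d v s
    vertices-distinguished {u} {v} tu tv u≢v with h u ≟ h v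
    ... | no hu≢hv = s₀ , s₀∈S , hu≢hv ∘ h-seen-from-outside tu tv
    ... | yes hu≡hv with fork (h u) tu tv refl (sym hu≡hv) u≢v
    ...   | f with fork-meets-S f
    ...     | inj₁ (s , s∈S , Desc-u′-s) = s , s∈S ,
                <⇒≢ (closer-in-own-branch Desc-u′-s Desc-u′-u Desc-v′-v hu≡hv)
      where
      open Fork f
      open ForkDistances f
    ...     | inj₂ (s , s∈S , Desc-v′-s) = s , s∈S ,
                ≢-sym (<⇒≢ (closer-in-own-branch Desc-v′-s Desc-v′-v Desc-u′-u (sym hu≡hv)))
      where
      open Fork f
      open ForkDistances (Fork-swap f)

    oriented-edges-distinguished : ∀ {ch₁ pa₁ ch₂ pa₂} → InT ch₁ → InT ch₂ →
      Adj G ch₁ pa₁ → h ch₁ ≡ suc (h pa₁) → Adj G ch₂ pa₂ → h ch₂ ≡ suc (h pa₂) → ch₁ ≢ ch₂ →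
      ∃[ s ] s ∈ S × d ch₁ s ⊓ d pa₁ s ≢ d ch₂ s ⊓ d pa₂ s
    oriented-edges-distinguished {ch₁} {pa₁} {ch₂} {pa₂} t₁ t₂ e₁ h₁ e₂ h₂ ch₁≢ch₂ with h ch₁ ≟ h ch₂
    ... | no h₁≢h₂ = s₀ , s₀∈S , λ d₁≡d₂ → h₁≢h₂ (trans h₁ (trans (cong suc (parents-level d₁≡d₂)) (sym h₂)))
      where
      parents-level : d ch₁ s₀ ⊓ d pa₁ s₀ ≡ d ch₂ s₀ ⊓ d pa₂ s₀ → h pa₁ ≡ h pa₂
      parents-level d₁≡d₂ =
        h-seen-from-outside (InT-closed t₁ (h≡suc⇒≢root h₁) e₁) (InT-closed t₂ (h≡suc⇒≢root h₂) e₂)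
          (trans (sym (edge-distance-from-outside t₁ e₁ h₁)) (trans d₁≡d₂ (edge-distance-from-outside t₂ e₂ h₂)))
    ... | yes h₁≡h₂ with fork (h ch₁) t₁ t₂ refl (sym h₁≡h₂) ch₁≢ch₂
    ...   | f with fork-meets-S f
    ...     | inj₁ (s , s∈S , Desc-u′-s) = s , s∈S , <⇒≢ (≤-<-trans (m⊓n≤m (d ch₁ s) (d pa₁ s))
                (⊓-glb (closer-in-own-branch Desc-u′-s Desc-u′-u Desc-v′-v h₁≡h₂)
                       (closer-than-parent-in-other-branch Desc-u′-s Desc-u′-u Desc-v′-v h₁≡h₂ e₂ h₂)))
      where
      open Fork f
      open ForkDistances f
    ...     | inj₂ (s , s∈S , Desc-v′-s) = s , s∈S , ≢-sym (<⇒≢ (≤-<-trans (m⊓n≤m (d ch₂ s) (d pa₂ s))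
                (⊓-glb (closer-in-own-branch Desc-v′-s Desc-v′-v Desc-u′-u (sym h₁≡h₂))
                       (closer-than-parent-in-other-branch Desc-v′-s Desc-v′-v Desc-u′-u (sym h₁≡h₂) e₁ h₁))))
      where
      open Fork f
      open ForkDistances (Fork-swap f)

    edges-distinguished : ∀ {a b x y} → InT a → InT b → InT x → InT y → Adj G a b → Adj G x y →
      ¬ SameEdge a b x y → ∃[ s ] s ∈ S × d a s ⊓ d b s ≢ d x s ⊓ d y s
    edges-distinguished ta tb tx ty a→b x→y ¬same with orient ta tb a→b | orient tx ty x→y
    ... | ch₁ , pa₁ , ab≈₁ , e₁ , h₁ , t₁ | ch₂ , pa₂ , xy≈₂ , e₂ , h₂ , t₂ with ch₁ ≟F ch₂
    ...   | yes refl =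
      ⊥-elim (¬same (SameEdge-trans ab≈₁ (SameEdge-sym (subst (SameEdge _ _ ch₁) (sym pa₁≡pa₂) xy≈₂))))
      where
      pa₁≡pa₂ : pa₁ ≡ pa₂
      pa₁≡pa₂ = parent-unique t₁ e₁ e₂ refl (suc-injective (trans (sym h₂) h₁)) h₁
    ...   | no ch₁≢ch₂ with oriented-edges-distinguished t₁ t₂ e₁ h₁ e₂ h₂ ch₁≢ch₂
    ...     | s , s∈S , d₁≢d₂ = s , s∈S , λ d≡ →
      d₁≢d₂ (trans (sym (SameEdge-⊓ (λ z → d z s) ab≈₁)) (trans d≡ (SameEdge-⊓ (λ z → d z s) xy≈₂)))

lemma3 : ∀ {n : ℕ} (G : Graph n) (c : List (Fin n)) →
    Connected G → IsCycle G c → UniqueCycle G c →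
    (S : Subset n) → BranchResolving G S → AtLeastTwoActive G c S →
    (∀ u v → SameComp G c u v → u ≢ v → DistinguishesV G S u v) ×
    (∀ a b x y → AdjMinus G c a b → AdjMinus G c x y →
    SameComp G c a x → ¬ SameEdge a b x y → DistinguishesE G S a b x y)
lemma3 {n} G c conn isC uc S br active = vertices , edges
  where
  open Unicyclic G c conn isC uc using (reaches-cycle; ~-sym; ~-trans; ~-step; Adj⁻-sym; d-Dist)
  module Rooted {r} (r∈c : r ∈L c) = Resolving G c conn isC uc r r∈c S br

  vertices : ∀ u v → SameComp G c u v → u ≢ v → DistinguishesV G S u v
  vertices u v u~v u≢v with reaches-cycle u
  ... | r , r∈c , u~r with Rooted.Separation.vertices-distinguished r∈c active u~r (~-trans (~-sym u~v) u~r) u≢v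
  ...   | s , s∈S , d≢ = s , s∈S , _ , _ , d-Dist u s , d-Dist v s , d≢

  edges : ∀ a b x y → AdjMinus G c a b → AdjMinus G c x y →
          SameComp G c a x → ¬ SameEdge a b x y → DistinguishesE G S a b x y
  edges a b x y ab xy a~x ¬same with reaches-cycle a
  ... | r , r∈c , a~r with ~-trans (~-sym a~x) a~r
  ...   | x~r with Rooted.Separation.edges-distinguished r∈c active
                     a~r (~-step (Adj⁻-sym ab) a~r) x~r (~-step (Adj⁻-sym xy) x~r) (proj₁ ab) (proj₁ xy) ¬same
  ...     | s , s∈S , d≢ =
    s , s∈S , _ , _ , (_ , _ , d-Dist a s , d-Dist b s , refl) , (_ , _ , d-Dist x s , d-Dist y s , refl) , d≢
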